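{- Let $D$ be a loose $k$-partite tournament ($k\ge3$), let $X_1$ be a partite set of $D$ that is not $\{1,2\}$-competing, and let $X_2,\dots,X_k$ be the remaining partite sets, labeled so that: for every anti-$\{1,2\}$-competing set $S\subseteq X_1$ containing at least two non-sink vertices, every non-sink vertex of $S$ has all of its out-neighbors in $X_2$. For $2\le i\le k$ let $F_i=\{v\in V(D): \emptyset\ne N^+(v)\subseteq X_i\}$. Then: (1) $F_i\subseteq X_1$ for every $2\le i\le k$; (2) $\bigcup_{i=3}^k X_i$ is a clique in $C_{1,2}(D)$, and every vertex of $\bigcup_{i=3}^k X_i$ is adjacent in $C_{1,2}(D)$ to every vertex of $X_2$; (3) for distinct $i,j\in\{2,\dots,k\}$, every vertex of $F_i$ is adjacent in $C_{1,2}(D)$ to every vertex of $F_j\cup X_j$; (4) for $i\in\{2,\dots,k\}$, a non-sink vertex $x$ with $N^+(x)\subseteq X_i$, and a vertex $y\in X_i$: $x$ and $y$ are not adjacent in $C_{1,2}(D)$ if and only if $N^+(x)=\{y\}$ or $N^+(y)=\{x\}$; (5) if $D$ has a sink or $X_1$ contains an anti-$\{1,2\}$-competing set of size at least three, then $V(D)\setminus X_1$ is a clique in $C_{1,2}(D)$.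
   Context: All graphs and digraphs are finite and simple. For a digraph $D$ and a vertex $v$, $N^+(v)$ is the out-neighborhood of $v$; a sink is a vertex of outdegree $0$. $d_D(x,y)$ is the length of a shortest directed path from $x$ to $y$ in $D$. The $(1,2)$-step competition graph $C_{1,2}(D)$ is the graph on $V(D)$ in which distinct $u,v$ are adjacent iff there is a vertex $w\notin\{u,v\}$ with either $d_{D-v}(u,w)\le 1$ and $d_{D-u}(v,w)\le 2$, or $d_{D-u}(v,w)\le 1$ and $d_{D-v}(u,w)\le 2$. A $k$-partite tournament is an orientation of a complete $k$-partite graph (with $k$ nonempty partite sets); a multipartite tournament is one with $k\ge 3$. A set of vertices is $\{1,2\}$-competing if it is a clique in $C_{1,2}(D)$, anti-$\{1,2\}$-competing if it is a stable set in $C_{1,2}(D)$. A multipartite tournament is loose if some partite set is not $\{1,2\}$-competing. -}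

module Defs where

open import Data.Nat using (ℕ; _≤_)
open import Data.Fin using (Fin)
open import Data.Fin.Subset using (Subset; _∈_; ∣_∣)
open import Data.Bool using (Bool; T)
open import Data.Product using (Σ; ∃; _×_; _,_)
open import Data.Sum using (_⊎_)
open import Data.Empty using (⊥)
open import Relation.Nullary using (¬_)
open import Relation.Binary.PropositionalEquality using (_≡_; _≢_)
open import Function.Bundles using (_⇔_)

record MultipartiteTournament (n k : ℕ) : Set where
  field
    arc        : Fin n → Fin n → Bool
    part       : Fin n → Fin k
    part-onto  : ∀ (i : Fin k) → ∃ λ v → part v ≡ i
    same-part  : ∀ u v → part u ≡ part v → ¬ T (arc u v)
    diff-part  : ∀ u v → part u ≢ part v → T (arc u v) ⊎ T (arc v u)
    asym       : ∀ u v → T (arc u v) → ¬ T (arc v u)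

module _ {n k : ℕ} (D : MultipartiteTournament n k) where
  open MultipartiteTournament D

  Arc : Fin n → Fin n → Set
  Arc u v = T (arc u v)

  InPart : Fin k → Fin n → Set
  InPart i v = part v ≡ i

  Sink : Fin n → Set
  Sink v = ∀ w → ¬ Arc v w

  NonSink : Fin n → Set
  NonSink v = ∃ λ w → Arc v w

  OutIn : Fin n → Fin k → Set
  OutIn v i = ∀ w → Arc v w → part w ≡ i

  F : Fin k → Fin n → Set
  F i v = NonSink v × OutIn v i

  OutIsSingleton : Fin n → Fin n → Set
  OutIsSingleton v y = ∀ w → Arc v w ⇔ (w ≡ y)

  -- d_{D - a}(v , w) ≤ 2, for distinct v, w (both different from a):
  -- an arc v → w, or a path v → z → w with z ≠ a.
  Dist≤2Avoiding : Fin n → Fin n → Fin n → Set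
  Dist≤2Avoiding a v w = Arc v w ⊎ (∃ λ z → z ≢ a × Arc v z × Arc z w)

  -- adjacency in the (1,2)-step competition graph C_{1,2}(D)
  -- (for w ∉ {u,v}, d_{D-v}(u,w) ≤ 1 just means the arc u → w)
  Adj : Fin n → Fin n → Set
  Adj u v = u ≢ v × ∃ λ w → w ≢ u × w ≢ v ×
              ((Arc u w × Dist≤2Avoiding u v w) ⊎ (Arc v w × Dist≤2Avoiding v u w))

  IsClique : (Fin n → Set) → Set
  IsClique P = ∀ u v → P u → P v → u ≢ v → Adj u v

  IsStable : (Fin n → Set) → Set
  IsStable P = ∀ u v → P u → P v → u ≢ v → ¬ Adj u v

  Competing : Subset n → Set
  Competing S = IsClique (_∈ S)

  AntiCompeting : Subset n → Set
  AntiCompeting S = IsStable (_∈ S)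

  Loose : Set
  Loose = ∃ λ (i : Fin k) → ¬ IsClique (InPart i)

  TwoNonSinks : Subset n → Set
  TwoNonSinks S = ∃ λ u → ∃ λ v → u ≢ v × u ∈ S × v ∈ S × NonSink u × NonSink v

  SubsetOfPart : Subset n → Fin k → Set
  SubsetOfPart S i = ∀ v → v ∈ S → part v ≡ i

{-# OPTIONS --safe #-}
-- Since X₁ is not {1,2}-competing it contains two distinct non-adjacent
-- vertices.  If one of them is a sink, take a = b = that sink; otherwise the
-- labelling hypothesis applies to the pair.  Either way we get "anchors"
-- a, b ∈ X₁ with N⁺(a), N⁺(b) ⊆ X₂ and no common out-neighbour.  Then every
-- vertex outside X₁ has an arc to a or to b, and every vertex outside X₁ ∪ X₂
-- has arcs to both.
-- All adjacencies claimed are obtained either from a common out-neighbour, or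
-- from out-neighbours w of x and t of y lying in different partite sets: the
-- arc between w and t extends one of x → w, y → t to a path of length 2.
module Submission where

open import Defs
open import Data.Nat using (ℕ; _≤_; s≤s)
open import Data.Fin using (Fin; zero; suc; _≟_)
open import Data.Fin.Properties using (any?; 0≢1+n; suc-injective)
open import Data.Fin.Subset using (Subset; _∈_; ∣_∣; Nonempty; ⁅_⁆; _∪_; inside; outside)
open import Data.Fin.Subset.Properties using (x∈⁅x⁆; x∈⁅y⁆⇒x≡y; x∈p∪q⁺; x∈p∪q⁻)
open import Data.Vec.Base using (_∷_; here; there)
open import Data.Bool.Properties using (T?)
open import Data.Product using (∃; ∃₂; _×_; _,_; proj₁)
open import Data.Sum using (_⊎_; inj₁; inj₂)
import Data.Sum as Sum
open import Data.Empty using (⊥-elim)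
open import Relation.Nullary using (¬_; Dec; yes; no)
open import Relation.Nullary.Decidable using (¬?; _×-dec_; _⊎-dec_; decidable-stable)
open import Relation.Binary.PropositionalEquality using (_≡_; _≢_; refl; sym; trans; subst; ≢-sym)
open import Function.Bundles using (_⇔_; mk⇔; Equivalence)

suc-≢ : ∀ {n} {a b : Fin n} → a ≢ b → suc a ≢ suc b
suc-≢ a≢b e = a≢b (suc-injective e)

nonempty-of-size : ∀ {n} (S : Subset n) → 1 ≤ ∣ S ∣ → Nonempty S
nonempty-of-size (inside ∷ S) _ = zero , here
nonempty-of-size (outside ∷ S) h with nonempty-of-size S h
... | a , a∈S = suc a , there a∈S

two-elements : ∀ {n} (S : Subset n) → 2 ≤ ∣ S ∣ → ∃₂ λ a b → a ≢ b × a ∈ S × b ∈ S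
two-elements (inside ∷ S) (s≤s h) with nonempty-of-size S h
... | b , b∈S = zero , suc b , 0≢1+n , here , there b∈S
two-elements (outside ∷ S) h with two-elements S h
... | a , b , a≢b , a∈S , b∈S = suc a , suc b , suc-≢ a≢b , there a∈S , there b∈S

three-elements : ∀ {n} (S : Subset n) → 3 ≤ ∣ S ∣ →
  ∃₂ λ a b → ∃ λ c → a ≢ b × a ≢ c × b ≢ c × a ∈ S × b ∈ S × c ∈ S
three-elements (inside ∷ S) (s≤s h) with two-elements S h
... | b , c , b≢c , b∈S , c∈S =
  zero , suc b , suc c , 0≢1+n , 0≢1+n , suc-≢ b≢c , here , there b∈S , there c∈S
three-elements (outside ∷ S) h with three-elements S h
... | a , b , c , a≢b , a≢c , b≢c , a∈S , b∈S , c∈S =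
  suc a , suc b , suc c , suc-≢ a≢b , suc-≢ a≢c , suc-≢ b≢c , there a∈S , there b∈S , there c∈S

∈-pair⁻ : ∀ {n} {a b x : Fin n} → x ∈ ⁅ a ⁆ ∪ ⁅ b ⁆ → x ≡ a ⊎ x ≡ b
∈-pair⁻ {a = a} {b} x∈ = Sum.map (x∈⁅y⁆⇒x≡y a) (x∈⁅y⁆⇒x≡y b) (x∈p∪q⁻ ⁅ a ⁆ ⁅ b ⁆ x∈)

∈-pairˡ : ∀ {n} (a b : Fin n) → a ∈ ⁅ a ⁆ ∪ ⁅ b ⁆
∈-pairˡ a b = x∈p∪q⁺ (inj₁ (x∈⁅x⁆ a))

∈-pairʳ : ∀ {n} (a b : Fin n) → b ∈ ⁅ a ⁆ ∪ ⁅ b ⁆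
∈-pairʳ a b = x∈p∪q⁺ (inj₂ (x∈⁅x⁆ b))

module _ {n k : ℕ} (D : MultipartiteTournament n k) where
  open MultipartiteTournament D

  DisjointOut : Fin n → Fin n → Set
  DisjointOut a b = ∀ w → Arc D a w → ¬ Arc D b w

  arc⇒part≢ : ∀ {u w} → Arc D u w → part u ≢ part w
  arc⇒part≢ {u} {w} uw e = same-part u w e uw

  part≢⇒≢ : ∀ {u v} → part u ≢ part v → u ≢ v
  part≢⇒≢ ne refl = ne refl

  arc⇒≢ : ∀ {u w} → Arc D u w → u ≢ w
  arc⇒≢ uw = part≢⇒≢ (arc⇒part≢ uw)

  inParts⇒part≢ : ∀ {i j u v} → InPart D i u → InPart D j v → i ≢ j → part u ≢ part v
  inParts⇒part≢ refl refl i≢j = i≢j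

  ∉part⇒part≢ : ∀ {p x y} → InPart D p y → part x ≢ p → part x ≢ part y
  ∉part⇒part≢ refl x∉p = x∉p

  inPart⇒∉part : ∀ {i j v} → InPart D j v → j ≢ i → part v ≢ i
  inPart⇒∉part refl j≢i = j≢i

  reverse-arc : ∀ {u v} → part u ≢ part v → ¬ Arc D v u → Arc D u v
  reverse-arc {u} {v} ne ¬vu with diff-part u v ne
  ... | inj₁ uv = uv
  ... | inj₂ vu = ⊥-elim (¬vu vu)

  Adj-sym : ∀ {u v} → Adj D u v → Adj D v u
  Adj-sym (u≢v , w , w≢u , w≢v , paths) = ≢-sym u≢v , w , w≢v , w≢u , Sum.swap paths

  common-out⇒Adj : ∀ {u v w} → Arc D u w → Arc D v w → u ≢ v → Adj D u v
  common-out⇒Adj uw vw u≢v =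
    u≢v , _ , ≢-sym (arc⇒≢ uw) , ≢-sym (arc⇒≢ vw) , inj₁ (uw , inj₁ vw)

  outs-in-distinct-parts⇒Adj : ∀ {x y w t} → x ≢ y → Arc D x w → Arc D y t → w ≢ y → t ≢ x →
    part w ≢ part t → Adj D x y
  outs-in-distinct-parts⇒Adj {x} {y} {w} {t} x≢y xw yt w≢y t≢x pw≢pt with diff-part w t pw≢pt
  ... | inj₁ wt = x≢y , t , t≢x , ≢-sym (arc⇒≢ yt) , inj₂ (yt , inj₂ (w , w≢y , xw , wt))
  ... | inj₂ tw = x≢y , w , ≢-sym (arc⇒≢ xw) , w≢y , inj₁ (xw , inj₂ (t , t≢x , yt , tw))

  ¬Adj⇒DisjointOut : ∀ {a b} → a ≢ b → ¬ Adj D a b → DisjointOut a b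
  ¬Adj⇒DisjointOut a≢b ¬adj w aw bw = ¬adj (common-out⇒Adj aw bw a≢b)

  arc-past : ∀ {a b x} → DisjointOut a b → part x ≢ part b → Arc D a x → Arc D x b
  arc-past disj x≢b ax = reverse-arc x≢b (disj _ ax)

  arc-to-one-of : ∀ {a b x} → DisjointOut a b → part x ≢ part a → part x ≢ part b →
    Arc D x a ⊎ Arc D x b
  arc-to-one-of {a} {b} {x} disj x≢a x≢b with diff-part x a x≢a
  ... | inj₁ xa = inj₁ xa
  ... | inj₂ ax = inj₂ (arc-past disj x≢b ax)

  -- Each of u, v misses at most one of a, b, c, so they share an out-neighbour among them.
  common-out-among-three : ∀ {p a b c u v} → InPart D p a → InPart D p b → InPart D p c →
    DisjointOut a b → DisjointOut a c → DisjointOut b c → part u ≢ p → part v ≢ p →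
    ∃ λ t → Arc D u t × Arc D v t
  common-out-among-three {a = a} {b} {c} {u} {v} pa pb pc dab dac dbc u∉p v∉p
    with diff-part u a (∉part⇒part≢ pa u∉p) | diff-part v a (∉part⇒part≢ pa v∉p)
  ... | inj₁ ua | inj₁ va = a , ua , va
  ... | inj₂ au | _ with arc-to-one-of dbc (∉part⇒part≢ pb v∉p) (∉part⇒part≢ pc v∉p)
  ...   | inj₁ vb = b , arc-past dab (∉part⇒part≢ pb u∉p) au , vb
  ...   | inj₂ vc = c , arc-past dac (∉part⇒part≢ pc u∉p) au , vc
  common-out-among-three {a = a} {b} {c} {u} {v} pa pb pc dab dac dbc u∉p v∉p
      | inj₁ ua | inj₂ av with arc-to-one-of dbc (∉part⇒part≢ pb u∉p) (∉part⇒part≢ pc u∉p)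
  ... | inj₁ ub = b , ub , arc-past dab (∉part⇒part≢ pb v∉p) av
  ... | inj₂ uc = c , uc , arc-past dac (∉part⇒part≢ pc v∉p) av

  arc? : ∀ u v → Dec (Arc D u v)
  arc? u v = T? (arc u v)

  dist≤2Avoiding? : ∀ a v w → Dec (Dist≤2Avoiding D a v w)
  dist≤2Avoiding? a v w = arc? v w ⊎-dec any? (λ z → ¬? (z ≟ a) ×-dec arc? v z ×-dec arc? z w)

  adj? : ∀ u v → Dec (Adj D u v)
  adj? u v = ¬? (u ≟ v) ×-dec any? (λ w → ¬? (w ≟ u) ×-dec ¬? (w ≟ v) ×-dec
    ((arc? u w ×-dec dist≤2Avoiding? u v w) ⊎-dec (arc? v w ×-dec dist≤2Avoiding? v u w)))

  sink⊎nonSink : ∀ v → Sink D v ⊎ NonSink D v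
  sink⊎nonSink v with any? (arc? v)
  ... | yes out = inj₂ out
  ... | no ¬out = inj₁ (λ w vw → ¬out (w , vw))

  ¬clique⇒nonAdjacent-pair : ∀ i → ¬ IsClique D (InPart D i) →
    ∃₂ λ a b → InPart D i a × InPart D i b × a ≢ b × ¬ Adj D a b
  ¬clique⇒nonAdjacent-pair i ¬clique
    with any? (λ a → any? (λ b → (part a ≟ i) ×-dec (part b ≟ i) ×-dec ¬? (a ≟ b) ×-dec ¬? (adj? a b)))
  ... | yes (a , pair) = a , pair
  ... | no none = ⊥-elim (¬clique (λ a b pa pb a≢b →
        decidable-stable (adj? a b) (λ ¬adj → none (a , b , pa , pb , a≢b , ¬adj))))

  other-out⊎singleton : ∀ u v → NonSink D u → (∃ λ w → Arc D u w × w ≢ v) ⊎ OutIsSingleton D u v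
  other-out⊎singleton u v (w₀ , uw₀) with any? (λ w → arc? u w ×-dec ¬? (w ≟ v))
  ... | yes other = inj₁ other
  ... | no ¬other = inj₂ (λ w → mk⇔ only (λ { refl → subst (Arc D u) (only uw₀) uw₀ }))
    where
      only : ∀ {w} → Arc D u w → w ≡ v
      only {w} uw = decidable-stable (w ≟ v) (λ w≢v → ¬other (w , uw , w≢v))

  singleton⇒¬Adj : ∀ {u v} → OutIsSingleton D u v → ¬ Adj D u v
  singleton⇒¬Adj only (_ , w , _ , w≢v , inj₁ (uw , _)) = w≢v (Equivalence.to (only w) uw)
  singleton⇒¬Adj only (_ , w , _ , w≢v , inj₂ (_ , inj₁ uw)) = w≢v (Equivalence.to (only w) uw)
  singleton⇒¬Adj only (_ , _ , _ , _ , inj₂ (_ , inj₂ (z , z≢v , uz , _))) = z≢v (Equivalence.to (only z) uz)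

  pair-antiCompeting : ∀ {a b} → a ≢ b → ¬ Adj D a b → AntiCompeting D (⁅ a ⁆ ∪ ⁅ b ⁆)
  pair-antiCompeting a≢b ¬adj u v u∈ v∈ u≢v with ∈-pair⁻ u∈ | ∈-pair⁻ v∈
  ... | inj₁ refl | inj₁ refl = ⊥-elim (u≢v refl)
  ... | inj₁ refl | inj₂ refl = ¬adj
  ... | inj₂ refl | inj₁ refl = λ adj → ¬adj (Adj-sym adj)
  ... | inj₂ refl | inj₂ refl = ⊥-elim (u≢v refl)

module Labelled {n k : ℕ} (D : MultipartiteTournament n k) (i₁ i₂ : Fin k) (i₁≢i₂ : i₁ ≢ i₂)
  (¬clique : ¬ IsClique D (InPart D i₁))
  (labelling : ∀ (S : Subset n) → SubsetOfPart D S i₁ → AntiCompeting D S → TwoNonSinks D S →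
    ∀ v → v ∈ S → NonSink D v → OutIn D v i₂) where
  open MultipartiteTournament D

  Anchor : Fin n → Set
  Anchor c = InPart D i₁ c × OutIn D c i₂

  record AnchorPair : Set where
    field
      a b      : Fin n
      anchor-a : Anchor a
      anchor-b : Anchor b
      disjoint : DisjointOut D a b

  sink-pair : ∀ s → InPart D i₁ s → Sink D s → AnchorPair
  sink-pair s s∈X₁ sink = record
    { a = s ; b = s
    ; anchor-a = s∈X₁ , no-out
    ; anchor-b = s∈X₁ , no-out
    ; disjoint = λ w sw _ → sink w sw }
    where
      no-out : OutIn D s i₂
      no-out w sw = ⊥-elim (sink w sw)

  nonSink-pair : ∀ a b → InPart D i₁ a → InPart D i₁ b → a ≢ b → ¬ Adj D a b →
    NonSink D a → NonSink D b → AnchorPair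
  nonSink-pair a b a∈X₁ b∈X₁ a≢b ¬adj out-a out-b = record
    { a = a ; b = b
    ; anchor-a = a∈X₁ , labelled a (∈-pairˡ a b) out-a
    ; anchor-b = b∈X₁ , labelled b (∈-pairʳ a b) out-b
    ; disjoint = ¬Adj⇒DisjointOut D a≢b ¬adj }
    where
      pair⊆X₁ : SubsetOfPart D (⁅ a ⁆ ∪ ⁅ b ⁆) i₁
      pair⊆X₁ v v∈ with ∈-pair⁻ v∈
      ... | inj₁ refl = a∈X₁
      ... | inj₂ refl = b∈X₁
      labelled : ∀ v → v ∈ ⁅ a ⁆ ∪ ⁅ b ⁆ → NonSink D v → OutIn D v i₂
      labelled = labelling (⁅ a ⁆ ∪ ⁅ b ⁆) pair⊆X₁ (pair-antiCompeting D a≢b ¬adj)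
        (a , b , a≢b , ∈-pairˡ a b , ∈-pairʳ a b , out-a , out-b)

  anchorPair : AnchorPair
  anchorPair with ¬clique⇒nonAdjacent-pair D i₁ ¬clique
  ... | a , b , a∈X₁ , b∈X₁ , a≢b , ¬adj with sink⊎nonSink D a | sink⊎nonSink D b
  ...   | inj₁ sink-a | _ = sink-pair a a∈X₁ sink-a
  ...   | inj₂ _ | inj₁ sink-b = sink-pair b b∈X₁ sink-b
  ...   | inj₂ out-a | inj₂ out-b = nonSink-pair a b a∈X₁ b∈X₁ a≢b ¬adj out-a out-b

  open AnchorPair anchorPair

  arc-to-anchor : ∀ u c → part u ≢ i₁ → part u ≢ i₂ → Anchor c → Arc D u c
  arc-to-anchor u c u∉X₁ u∉X₂ (c∈X₁ , c-out) =
    reverse-arc D (∉part⇒part≢ D c∈X₁ u∉X₁) (λ cu → u∉X₂ (c-out u cu))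

  anchored : ∀ v → part v ≢ i₁ → ∃ λ c → Anchor c × Arc D v c
  anchored v v∉X₁ with arc-to-one-of D disjoint (∉part⇒part≢ D (proj₁ anchor-a) v∉X₁)
                                                 (∉part⇒part≢ D (proj₁ anchor-b) v∉X₁)
  ... | inj₁ va = a , anchor-a , va
  ... | inj₂ vb = b , anchor-b , vb

  other-anchor : ∀ u → NonSink D u → ∃ λ c → Anchor c × c ≢ u
  other-anchor u (w , uw) with a ≟ u | b ≟ u
  ... | no a≢u | _ = a , anchor-a , a≢u
  ... | yes _ | no b≢u = b , anchor-b , b≢u
  ... | yes a≡u | yes b≡u =
    ⊥-elim (disjoint w (subst (λ x → Arc D x w) (sym a≡u) uw) (subst (λ x → Arc D x w) (sym b≡u) uw))

  nonSink-outside-X₁ : ∀ v → part v ≢ i₁ → NonSink D v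
  nonSink-outside-X₁ v v∉X₁ with anchored v v∉X₁
  ... | c , _ , vc = c , vc

  sink∈X₁ : ∀ s → Sink D s → InPart D i₁ s
  sink∈X₁ s sink = decidable-stable (part s ≟ i₁) λ s∉X₁ →
    let (w , sw) = nonSink-outside-X₁ s s∉X₁ in sink w sw

  F⊆X₁ : ∀ i → i ≢ i₁ → ∀ v → F D i v → InPart D i₁ v
  F⊆X₁ i i≢i₁ v (_ , v-out) = decidable-stable (part v ≟ i₁) λ v∉X₁ →
    let (c , (c∈X₁ , _) , vc) = anchored v v∉X₁ in i≢i₁ (trans (sym (v-out c vc)) c∈X₁)

  outside-X₁X₂-clique : IsClique D (λ v → part v ≢ i₁ × part v ≢ i₂)
  outside-X₁X₂-clique u v (u∉X₁ , u∉X₂) (v∉X₁ , v∉X₂) u≢v =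
    common-out⇒Adj D (arc-to-anchor u a u∉X₁ u∉X₂ anchor-a) (arc-to-anchor v a v∉X₁ v∉X₂ anchor-a) u≢v

  outside-X₁X₂-Adj-X₂ : ∀ u v → part u ≢ i₁ → part u ≢ i₂ → InPart D i₂ v → Adj D u v
  outside-X₁X₂-Adj-X₂ u v u∉X₁ u∉X₂ v∈X₂ with anchored v (inPart⇒∉part D v∈X₂ (≢-sym i₁≢i₂))
  ... | c , anchor-c , vc =
    common-out⇒Adj D (arc-to-anchor u c u∉X₁ u∉X₂ anchor-c) vc (part≢⇒≢ D (∉part⇒part≢ D v∈X₂ u∉X₂))

  arc-into-X₁-avoiding : ∀ {i} u v → F D i u → part v ≢ i₁ → part v ≢ i →
    ∃ λ c → InPart D i₁ c × c ≢ u × Arc D v c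
  arc-into-X₁-avoiding u v ((w , uw) , u-out) v∉X₁ v∉Xᵢ with part v ≟ i₂
  ... | yes v∈X₂ with anchored v v∉X₁
  ...   | c , (c∈X₁ , c-out) , vc =
          c , c∈X₁ , (λ { refl → v∉Xᵢ (trans v∈X₂ (trans (sym (c-out w uw)) (u-out w uw))) }) , vc
  arc-into-X₁-avoiding u v ((w , uw) , u-out) v∉X₁ v∉Xᵢ | no v∉X₂ with other-anchor u (w , uw)
  ... | c , anchor-c , c≢u = c , proj₁ anchor-c , c≢u , arc-to-anchor v c v∉X₁ v∉X₂ anchor-c

  F-Adj-F∪X : ∀ i j → i ≢ i₁ → j ≢ i₁ → i ≢ j → ∀ u v → F D i u → (F D j v ⊎ InPart D j v) → Adj D u v
  F-Adj-F∪X i j i≢i₁ j≢i₁ i≢j u v u∈Fᵢ@((w , uw) , u-out) (inj₁ v∈Fⱼ@((z , vz) , v-out)) =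
    outs-in-distinct-parts⇒Adj D u≢v uw vz
      (part≢⇒≢ D (inParts⇒part≢ D (u-out w uw) (F⊆X₁ j j≢i₁ v v∈Fⱼ) i≢i₁))
      (part≢⇒≢ D (inParts⇒part≢ D (v-out z vz) (F⊆X₁ i i≢i₁ u u∈Fᵢ) j≢i₁))
      (inParts⇒part≢ D (u-out w uw) (v-out z vz) i≢j)
    where
      u≢v : u ≢ v
      u≢v refl = i≢j (trans (sym (u-out w uw)) (v-out w uw))
  F-Adj-F∪X i j i≢i₁ j≢i₁ i≢j u v u∈Fᵢ@((w , uw) , u-out) (inj₂ v∈Xⱼ)
    with arc-into-X₁-avoiding u v u∈Fᵢ (inPart⇒∉part D v∈Xⱼ j≢i₁) (inPart⇒∉part D v∈Xⱼ (≢-sym i≢j))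
  ... | c , c∈X₁ , c≢u , vc =
    outs-in-distinct-parts⇒Adj D
      (part≢⇒≢ D (inParts⇒part≢ D (F⊆X₁ i i≢i₁ u u∈Fᵢ) v∈Xⱼ (≢-sym j≢i₁)))
      uw vc (part≢⇒≢ D (inParts⇒part≢ D (u-out w uw) v∈Xⱼ i≢j)) c≢u
      (inParts⇒part≢ D (u-out w uw) c∈X₁ i≢i₁)

  F-¬Adj⇔singleton : ∀ i → i ≢ i₁ → ∀ x y → NonSink D x → OutIn D x i → InPart D i y →
    (¬ Adj D x y) ⇔ (OutIsSingleton D x y ⊎ OutIsSingleton D y x)
  F-¬Adj⇔singleton i i≢i₁ x y x-nonSink x-out y∈Xᵢ = mk⇔ to from
    where
      y∉X₁ : part y ≢ i₁
      y∉X₁ = inPart⇒∉part D y∈Xᵢ i≢i₁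
      x≢y : x ≢ y
      x≢y = part≢⇒≢ D (inParts⇒part≢ D (F⊆X₁ i i≢i₁ x (x-nonSink , x-out)) y∈Xᵢ (≢-sym i≢i₁))
      from : OutIsSingleton D x y ⊎ OutIsSingleton D y x → ¬ Adj D x y
      from (inj₁ only) = singleton⇒¬Adj D only
      from (inj₂ only) adj = singleton⇒¬Adj D only (Adj-sym D adj)
      to : ¬ Adj D x y → OutIsSingleton D x y ⊎ OutIsSingleton D y x
      to ¬adj with other-out⊎singleton D x y x-nonSink | other-out⊎singleton D y x (nonSink-outside-X₁ y y∉X₁)
      ... | inj₂ only | _ = inj₁ only
      ... | inj₁ _ | inj₂ only = inj₂ only
      ... | inj₁ (w , xw , w≢y) | inj₁ (t , yt , t≢x) = ⊥-elim (¬adj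
            (outs-in-distinct-parts⇒Adj D x≢y xw yt w≢y t≢x (inParts⇒part≢ D (x-out w xw) refl
              (λ e → arc⇒part≢ D yt (trans y∈Xᵢ e)))))

  sink⊎stableTriple⇒outside-X₁-clique :
    (∃ (Sink D) ⊎ (∃ λ (S : Subset n) → SubsetOfPart D S i₁ × AntiCompeting D S × 3 ≤ ∣ S ∣)) →
    IsClique D (λ v → part v ≢ i₁)
  sink⊎stableTriple⇒outside-X₁-clique (inj₁ (s , sink)) u v u∉X₁ v∉X₁ u≢v =
    common-out⇒Adj D (to-sink u u∉X₁) (to-sink v v∉X₁) u≢v
    where
      to-sink : ∀ x → part x ≢ i₁ → Arc D x s
      to-sink x x∉X₁ = reverse-arc D (∉part⇒part≢ D (sink∈X₁ s sink) x∉X₁) (sink x)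
  sink⊎stableTriple⇒outside-X₁-clique (inj₂ (S , S⊆X₁ , stable , 3≤∣S∣)) u v u∉X₁ v∉X₁ u≢v
    with three-elements S 3≤∣S∣
  ... | a , b , c , a≢b , a≢c , b≢c , a∈S , b∈S , c∈S
    with common-out-among-three D (S⊆X₁ a a∈S) (S⊆X₁ b b∈S) (S⊆X₁ c c∈S)
           (disjoint-in-S a≢b a∈S b∈S) (disjoint-in-S a≢c a∈S c∈S) (disjoint-in-S b≢c b∈S c∈S) u∉X₁ v∉X₁
    where
      disjoint-in-S : ∀ {x y} → x ≢ y → x ∈ S → y ∈ S → DisjointOut D x y
      disjoint-in-S x≢y x∈S y∈S = ¬Adj⇒DisjointOut D x≢y (stable _ _ x∈S y∈S x≢y)
  ... | t , ut , vt = common-out⇒Adj D ut vt u≢v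

theorem3p3 : ∀ {n k : ℕ} (D : MultipartiteTournament n k) → 3 ≤ k → Loose D →
    ∀ (i₁ i₂ : Fin k) → i₁ ≢ i₂ →
    -- X₁ = part i₁ is not {1,2}-competing
    ¬ IsClique D (InPart D i₁) →
    -- labelling hypothesis on X₂ = part i₂
    (∀ (S : Subset n) → SubsetOfPart D S i₁ → AntiCompeting D S → TwoNonSinks D S →
       ∀ v → v ∈ S → NonSink D v → OutIn D v i₂) →
    -- (1)
    (∀ (i : Fin k) → i ≢ i₁ → ∀ v → F D i v → InPart D i₁ v)
    -- (2)
    × IsClique D (λ v → MultipartiteTournament.part D v ≢ i₁ × MultipartiteTournament.part D v ≢ i₂)
    × (∀ u v → MultipartiteTournament.part D u ≢ i₁ → MultipartiteTournament.part D u ≢ i₂ →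
         InPart D i₂ v → Adj D u v)
    -- (3)
    × (∀ (i j : Fin k) → i ≢ i₁ → j ≢ i₁ → i ≢ j →
         ∀ u v → F D i u → (F D j v ⊎ InPart D j v) → Adj D u v)
    -- (4)
    × (∀ (i : Fin k) → i ≢ i₁ → ∀ x y → NonSink D x → OutIn D x i → InPart D i y →
         (¬ Adj D x y) ⇔ (OutIsSingleton D x y ⊎ OutIsSingleton D y x))
    -- (5)
    × ((∃ (Sink D) ⊎ (∃ λ (S : Subset n) → SubsetOfPart D S i₁ × AntiCompeting D S × 3 ≤ ∣ S ∣)) →
         IsClique D (λ v → MultipartiteTournament.part D v ≢ i₁))
theorem3p3 D _ _ i₁ i₂ i₁≢i₂ ¬clique labelling =
  F⊆X₁ , outside-X₁X₂-clique , outside-X₁X₂-Adj-X₂ , F-Adj-F∪X , F-¬Adj⇔singleton ,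
  sink⊎stableTriple⇒outside-X₁-clique
  where open Labelled D i₁ i₂ i₁≢i₂ ¬clique labelling
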